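{- For $i=1,2$ let $A_i\in M_{g_i,n_i}(\mathbb{Z})$ be a simple totally unimodular matrix and let $Q_i$ be a positive definite quadratic form of rank $g_i$ which is well-suited for $A_i$. Then $Q=\begin{pmatrix}Q_1&0\\0&Q_2\end{pmatrix}$ is well-suited for $A=\begin{pmatrix}A_1&0\\0&A_2\end{pmatrix}$.
   Context: A matrix is totally unimodular if every square submatrix has determinant in $\{ -1,0,1\}$; it is simple if it has no zero column and no two proportional columns. For a simple totally unimodular $A\in M_{g,n}(\mathbb{Z})$, a symmetric matrix $Q\in M_{g,g}(\mathbb{R})$ is well-suited for $A$ if $Q$ is positive definite and for every $\xi\in\mathbb{Z}^g\setminus\{0\}$ one has $Q(\xi)=\xi^tQ\xi\ge1$, with equality if and only if $\pm\xi$ equals one of the column vectors of $A$. -}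

module Defs where

open import Data.Nat as ℕ using (ℕ; zero; suc)
open import Data.Integer as ℤ using (ℤ; +_; -[1+_])
open import Data.Fin as Fin using (Fin; zero; suc; splitAt; punchIn)
open import Data.Sum using (_⊎_; inj₁; inj₂)
open import Data.Product using (Σ; ∃; _×_; _,_)
open import Relation.Binary.PropositionalEquality using (_≡_; _≢_)
open import Relation.Nullary using (¬_)
open import Algebra.Structures using (IsCommutativeRing)

-- The real numbers, axiomatised as a complete ordered field
-- (any model of this record is isomorphic to ℝ).

record RealField : Set₁ where
  infixl 6 _+_
  infixl 7 _*_
  infix  4 _<_ _≤_
  field
    Carrier : Set
    _+_ _*_ : Carrier → Carrier → Carrier
    -_      : Carrier → Carrier
    0# 1#   : Carrier
    isCommutativeRing : IsCommutativeRing _≡_ _+_ _*_ -_ 0# 1#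
    0≢1     : 0# ≢ 1#
    _⁻¹     : (x : Carrier) → x ≢ 0# → Carrier
    ⁻¹-inverse : (x : Carrier) (p : x ≢ 0#) → x * (_⁻¹ x p) ≡ 1#
    _<_     : Carrier → Carrier → Set
    <-irrefl : ∀ x → ¬ (x < x)
    <-trans  : ∀ {x y z} → x < y → y < z → x < z
    <-trichotomy : ∀ x y → (x < y) ⊎ ((x ≡ y) ⊎ (y < x))
    +-mono-<  : ∀ {x y} z → x < y → x + z < y + z
    *-pos     : ∀ {x y} → 0# < x → 0# < y → 0# < x * y
    sup : (S : Carrier → Set) → (∃ λ x → S x) →
          (∃ λ b → ∀ x → S x → (x < b ⊎ x ≡ b)) →
          ∃ λ s → (∀ x → S x → (x < s ⊎ x ≡ s)) ×
                  (∀ b → (∀ x → S x → (x < b ⊎ x ≡ b)) → (s < b ⊎ s ≡ b))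

  _≤_ : Carrier → Carrier → Set
  x ≤ y = (x < y) ⊎ (x ≡ y)

  fromℕ : ℕ → Carrier
  fromℕ zero    = 0#
  fromℕ (suc n) = 1# + fromℕ n

  fromℤ : ℤ → Carrier
  fromℤ (+ n)      = fromℕ n
  fromℤ -[1+ n ]   = - fromℕ (suc n)

Matrix : Set → ℕ → ℕ → Set
Matrix A m n = Fin m → Fin n → A

sumFin : {A : Set} → (A → A → A) → A → ∀ {k} → (Fin k → A) → A
sumFin _+_ z {zero}  f = z
sumFin _+_ z {suc k} f = f zero + sumFin _+_ z (λ i → f (suc i))

det : ∀ {k} → Matrix ℤ k k → ℤ
det {zero}  M = + 1
det {suc k} M =
  sumFin ℤ._+_ (+ 0) (λ j → sign j ℤ.* (M zero j ℤ.* det (λ i l → M (suc i) (punchIn j l))))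
  where
  sign : ∀ {m} → Fin m → ℤ
  sign zero    = + 1
  sign (suc j) = ℤ.- sign j

StrictlyIncreasing : ∀ {k m} → (Fin k → Fin m) → Set
StrictlyIncreasing f = ∀ i j → i Fin.< j → f i Fin.< f j

TotallyUnimodular : ∀ {g n} → Matrix ℤ g n → Set
TotallyUnimodular {g} {n} A =
  ∀ k (r : Fin k → Fin g) (c : Fin k → Fin n) →
  StrictlyIncreasing r → StrictlyIncreasing c →
  let d = det (λ i j → A (r i) (c j)) in
  (d ≡ ℤ.- (+ 1)) ⊎ ((d ≡ + 0) ⊎ (d ≡ + 1))

column : ∀ {g n} → Matrix ℤ g n → Fin n → (Fin g → ℤ)
column A j i = A i j

IsZeroVec : ∀ {g} → (Fin g → ℤ) → Set
IsZeroVec v = ∀ i → v i ≡ + 0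

Proportional : ∀ {g} → (Fin g → ℤ) → (Fin g → ℤ) → Set
Proportional u v = ∃ λ a → ∃ λ b → ¬ (a ≡ + 0 × b ≡ + 0) × (∀ i → a ℤ.* u i ≡ b ℤ.* v i)

Simple : ∀ {g n} → Matrix ℤ g n → Set
Simple A = (∀ j → ¬ IsZeroVec (column A j)) ×
           (∀ j j' → j ≢ j' → ¬ Proportional (column A j) (column A j'))

module _ (ℝ : RealField) where
  open RealField ℝ

  Symmetric : ∀ {g} → Matrix Carrier g g → Set
  Symmetric Q = ∀ i j → Q i j ≡ Q j i

  qf : ∀ {g} → Matrix Carrier g g → (Fin g → Carrier) → Carrier
  qf Q x = sumFin _+_ 0# (λ i → sumFin _+_ 0# (λ j → x i * (Q i j * x j)))

  PositiveDefinite : ∀ {g} → Matrix Carrier g g → Set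
  PositiveDefinite Q = Symmetric Q × (∀ x → ¬ (∀ i → x i ≡ 0#) → 0# < qf Q x)

  WellSuited : ∀ {g n} → Matrix ℤ g n → Matrix Carrier g g → Set
  WellSuited {g} {n} A Q =
    PositiveDefinite Q ×
    (∀ (ξ : Fin g → ℤ) → ¬ IsZeroVec ξ →
       (1# ≤ qf Q (λ i → fromℤ (ξ i))) ×
       ((qf Q (λ i → fromℤ (ξ i)) ≡ 1#) →
          ∃ λ j → (∀ i → ξ i ≡ A i j) ⊎ (∀ i → ℤ.- ξ i ≡ A i j)) ×
       ((∃ λ j → (∀ i → ξ i ≡ A i j) ⊎ (∀ i → ℤ.- ξ i ≡ A i j)) →
          qf Q (λ i → fromℤ (ξ i)) ≡ 1#))

blockDiag : {A : Set} → A → ∀ {m₁ n₁ m₂ n₂} →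
            Matrix A m₁ n₁ → Matrix A m₂ n₂ → Matrix A (m₁ ℕ.+ m₂) (n₁ ℕ.+ n₂)
blockDiag z {m₁} {n₁} M₁ M₂ i j with splitAt m₁ i | splitAt n₁ j
... | inj₁ i₁ | inj₁ j₁ = M₁ i₁ j₁
... | inj₂ i₂ | inj₂ j₂ = M₂ i₂ j₂
... | inj₁ _  | inj₂ _  = z
... | inj₂ _  | inj₁ _  = z

-- Split ξ into its halves ξ₁, ξ₂. Then Q(ξ) = Q₁(ξ₁) + Q₂(ξ₂), and ±ξ is a column of A exactly
-- when one half vanishes and ± the other half is a column of the corresponding Aᵢ. So if one
-- half vanishes, the claim for ξ is the claim for the other half; if neither does, then
-- Q(ξ) ≥ 1 + 1 > 1 and ±ξ is no column.
module Submission where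

open import Defs
open import Data.Nat using (ℕ)
open import Data.Integer using (ℤ; +_)

import Data.Nat as ℕ
import Data.Integer as ℤ
open import Data.Integer.Properties using (neg-injective)
open import Data.Fin using (Fin; zero; suc; splitAt; join; _↑ˡ_; _↑ʳ_)
open import Data.Fin.Properties using (splitAt-↑ˡ; splitAt-↑ʳ; join-splitAt; all?)
open import Data.Vec.Functional using (take; drop)
open import Data.Sum using (_⊎_; inj₁; inj₂; [_,_])
open import Data.Product using (∃; _×_; _,_; proj₁; proj₂)
open import Data.Empty using (⊥-elim)
open import Function.Base using (_∘_)
open import Function.Bundles using (_⇔_; mk⇔; Equivalence)
import Function.Properties.Equivalence as ⇔
open import Relation.Binary.PropositionalEquality using (_≡_; refl; sym; trans; cong; cong₂; subst; subst₂; module ≡-Reasoning)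
open import Relation.Nullary using (¬_; Dec; yes; no)
open import Algebra.Structures using (IsCommutativeRing)
open import Algebra.Bundles using (Ring)
import Algebra.Properties.Ring as RingProperties

open Equivalence using (to; from)

↑-elim : ∀ {m n} (P : Fin (m ℕ.+ n) → Set) →
         (∀ i → P (i ↑ˡ n)) → (∀ i → P (m ↑ʳ i)) → ∀ i → P i
↑-elim {m} {n} P left right i = subst P (join-splitAt m n i) (by-cases (splitAt m i))
  where
  by-cases : (s : Fin m ⊎ Fin n) → P (join m n s)
  by-cases (inj₁ i₁) = left i₁
  by-cases (inj₂ i₂) = right i₂

module _ {A : Set} (z : A) {m₁ n₁ m₂ n₂} (M₁ : Matrix A m₁ n₁) (M₂ : Matrix A m₂ n₂) where

  blockDiag-↑ˡ-↑ˡ : ∀ i j → blockDiag z M₁ M₂ (i ↑ˡ m₂) (j ↑ˡ n₂) ≡ M₁ i j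
  blockDiag-↑ˡ-↑ˡ i j rewrite splitAt-↑ˡ m₁ i m₂ | splitAt-↑ˡ n₁ j n₂ = refl

  blockDiag-↑ˡ-↑ʳ : ∀ i j → blockDiag z M₁ M₂ (i ↑ˡ m₂) (n₁ ↑ʳ j) ≡ z
  blockDiag-↑ˡ-↑ʳ i j rewrite splitAt-↑ˡ m₁ i m₂ | splitAt-↑ʳ n₁ n₂ j = refl

  blockDiag-↑ʳ-↑ˡ : ∀ i j → blockDiag z M₁ M₂ (m₁ ↑ʳ i) (j ↑ˡ n₂) ≡ z
  blockDiag-↑ʳ-↑ˡ i j rewrite splitAt-↑ʳ m₁ m₂ i | splitAt-↑ˡ n₁ j n₂ = refl

  blockDiag-↑ʳ-↑ʳ : ∀ i j → blockDiag z M₁ M₂ (m₁ ↑ʳ i) (n₁ ↑ʳ j) ≡ M₂ i j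
  blockDiag-↑ʳ-↑ʳ i j rewrite splitAt-↑ʳ m₁ m₂ i | splitAt-↑ʳ n₁ n₂ j = refl

blockDiag-symmetric : ∀ {A : Set} (z : A) {m₁ m₂} (M₁ : Matrix A m₁ m₁) (M₂ : Matrix A m₂ m₂) →
  (∀ i j → M₁ i j ≡ M₁ j i) → (∀ i j → M₂ i j ≡ M₂ j i) →
  ∀ i j → blockDiag z M₁ M₂ i j ≡ blockDiag z M₁ M₂ j i
blockDiag-symmetric z M₁ M₂ sym₁ sym₂ = ↑-elim _
  (λ i → ↑-elim _
    (λ j → trans (blockDiag-↑ˡ-↑ˡ z M₁ M₂ i j) (trans (sym₁ i j) (sym (blockDiag-↑ˡ-↑ˡ z M₁ M₂ j i))))
    (λ j → trans (blockDiag-↑ˡ-↑ʳ z M₁ M₂ i j) (sym (blockDiag-↑ʳ-↑ˡ z M₁ M₂ j i))))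
  (λ i → ↑-elim _
    (λ j → trans (blockDiag-↑ʳ-↑ˡ z M₁ M₂ i j) (sym (blockDiag-↑ˡ-↑ʳ z M₁ M₂ j i)))
    (λ j → trans (blockDiag-↑ʳ-↑ʳ z M₁ M₂ i j) (trans (sym₂ i j) (sym (blockDiag-↑ʳ-↑ʳ z M₁ M₂ j i)))))

SignedColumn : ∀ {g n} → Matrix ℤ g n → (Fin g → ℤ) → Fin n → Set
SignedColumn A ξ j = (∀ i → ξ i ≡ A i j) ⊎ (∀ i → ℤ.- ξ i ≡ A i j)

IsSignedColumn : ∀ {g n} → Matrix ℤ g n → (Fin g → ℤ) → Set
IsSignedColumn A ξ = ∃ (SignedColumn A ξ)

isZeroVec-neg : ∀ {g} (ξ : Fin g → ℤ) → IsZeroVec (ℤ.-_ ∘ ξ) ⇔ IsZeroVec ξ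
isZeroVec-neg ξ = mk⇔ (λ z i → neg-injective (z i)) (λ z i → cong ℤ.-_ (z i))

module _ {g₁ n₁ g₂ n₂} (A₁ : Matrix ℤ g₁ n₁) (A₂ : Matrix ℤ g₂ n₂) where

  private
    B : Matrix ℤ (g₁ ℕ.+ g₂) (n₁ ℕ.+ n₂)
    B = blockDiag (+ 0) A₁ A₂

  column-↑ˡ-blockDiag : ∀ (ζ : Fin (g₁ ℕ.+ g₂) → ℤ) j →
    (∀ i → ζ i ≡ B i (j ↑ˡ n₂)) ⇔ ((∀ i → take g₁ ζ i ≡ A₁ i j) × IsZeroVec (drop g₁ ζ))
  column-↑ˡ-blockDiag ζ j = mk⇔
    (λ s → (λ i → trans (s _) (blockDiag-↑ˡ-↑ˡ (+ 0) A₁ A₂ i j)) ,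
           (λ i → trans (s _) (blockDiag-↑ʳ-↑ˡ (+ 0) A₁ A₂ i j)))
    (λ (s , z) → ↑-elim _ (λ i → trans (s i) (sym (blockDiag-↑ˡ-↑ˡ (+ 0) A₁ A₂ i j)))
                          (λ i → trans (z i) (sym (blockDiag-↑ʳ-↑ˡ (+ 0) A₁ A₂ i j))))

  column-↑ʳ-blockDiag : ∀ (ζ : Fin (g₁ ℕ.+ g₂) → ℤ) j →
    (∀ i → ζ i ≡ B i (n₁ ↑ʳ j)) ⇔ ((∀ i → drop g₁ ζ i ≡ A₂ i j) × IsZeroVec (take g₁ ζ))
  column-↑ʳ-blockDiag ζ j = mk⇔
    (λ s → (λ i → trans (s _) (blockDiag-↑ʳ-↑ʳ (+ 0) A₁ A₂ i j)) ,
           (λ i → trans (s _) (blockDiag-↑ˡ-↑ʳ (+ 0) A₁ A₂ i j)))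
    (λ (s , z) → ↑-elim _ (λ i → trans (z i) (sym (blockDiag-↑ˡ-↑ʳ (+ 0) A₁ A₂ i j)))
                          (λ i → trans (s i) (sym (blockDiag-↑ʳ-↑ʳ (+ 0) A₁ A₂ i j))))

  signedColumn-↑ˡ-blockDiag : ∀ ξ j →
    SignedColumn B ξ (j ↑ˡ n₂) ⇔ (SignedColumn A₁ (take g₁ ξ) j × IsZeroVec (drop g₁ ξ))
  signedColumn-↑ˡ-blockDiag ξ j = mk⇔
    (λ { (inj₁ s) → let (a , z) = to (column-↑ˡ-blockDiag ξ j) s in inj₁ a , z
       ; (inj₂ s) → let (a , z) = to (column-↑ˡ-blockDiag (ℤ.-_ ∘ ξ) j) s
                    in inj₂ a , to (isZeroVec-neg (drop g₁ ξ)) z })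
    (λ { (inj₁ a , z) → inj₁ (from (column-↑ˡ-blockDiag ξ j) (a , z))
       ; (inj₂ a , z) → inj₂ (from (column-↑ˡ-blockDiag (ℤ.-_ ∘ ξ) j)
                                    (a , from (isZeroVec-neg (drop g₁ ξ)) z)) })

  signedColumn-↑ʳ-blockDiag : ∀ ξ j →
    SignedColumn B ξ (n₁ ↑ʳ j) ⇔ (SignedColumn A₂ (drop g₁ ξ) j × IsZeroVec (take g₁ ξ))
  signedColumn-↑ʳ-blockDiag ξ j = mk⇔
    (λ { (inj₁ s) → let (a , z) = to (column-↑ʳ-blockDiag ξ j) s in inj₁ a , z
       ; (inj₂ s) → let (a , z) = to (column-↑ʳ-blockDiag (ℤ.-_ ∘ ξ) j) s
                    in inj₂ a , to (isZeroVec-neg (take g₁ ξ)) z })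
    (λ { (inj₁ a , z) → inj₁ (from (column-↑ʳ-blockDiag ξ j) (a , z))
       ; (inj₂ a , z) → inj₂ (from (column-↑ʳ-blockDiag (ℤ.-_ ∘ ξ) j)
                                    (a , from (isZeroVec-neg (take g₁ ξ)) z)) })

  isSignedColumn-blockDiag : ∀ ξ → IsSignedColumn B ξ ⇔
    ((IsSignedColumn A₁ (take g₁ ξ) × IsZeroVec (drop g₁ ξ)) ⊎
     (IsSignedColumn A₂ (drop g₁ ξ) × IsZeroVec (take g₁ ξ)))
  isSignedColumn-blockDiag ξ = mk⇔
    (λ (j , s) → ↑-elim (λ j → SignedColumn B ξ j → _)
      (λ j s → let (a , z) = to (signedColumn-↑ˡ-blockDiag ξ j) s in inj₁ ((j , a) , z))
      (λ j s → let (a , z) = to (signedColumn-↑ʳ-blockDiag ξ j) s in inj₂ ((j , a) , z)) j s)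
    (λ { (inj₁ ((j , a) , z)) → j ↑ˡ n₂ , from (signedColumn-↑ˡ-blockDiag ξ j) (a , z)
       ; (inj₂ ((j , a) , z)) → n₁ ↑ʳ j , from (signedColumn-↑ʳ-blockDiag ξ j) (a , z) })

  isSignedColumn-blockDiag-takeZero : ∀ ξ → IsZeroVec (take g₁ ξ) → ¬ IsZeroVec (drop g₁ ξ) →
    IsSignedColumn B ξ ⇔ IsSignedColumn A₂ (drop g₁ ξ)
  isSignedColumn-blockDiag-takeZero ξ ξ₁≡0 ξ₂≢0 = mk⇔
    ([ (λ (_ , ξ₂≡0) → ⊥-elim (ξ₂≢0 ξ₂≡0)) , proj₁ ] ∘ to (isSignedColumn-blockDiag ξ))
    (λ c → from (isSignedColumn-blockDiag ξ) (inj₂ (c , ξ₁≡0)))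

  isSignedColumn-blockDiag-dropZero : ∀ ξ → IsZeroVec (drop g₁ ξ) → ¬ IsZeroVec (take g₁ ξ) →
    IsSignedColumn B ξ ⇔ IsSignedColumn A₁ (take g₁ ξ)
  isSignedColumn-blockDiag-dropZero ξ ξ₂≡0 ξ₁≢0 = mk⇔
    ([ proj₁ , (λ (_ , ξ₁≡0) → ⊥-elim (ξ₁≢0 ξ₁≡0)) ] ∘ to (isSignedColumn-blockDiag ξ))
    (λ c → from (isSignedColumn-blockDiag ξ) (inj₁ (c , ξ₂≡0)))

  ¬isSignedColumn-blockDiag : ∀ ξ → ¬ IsZeroVec (take g₁ ξ) → ¬ IsZeroVec (drop g₁ ξ) →
    ¬ IsSignedColumn B ξ
  ¬isSignedColumn-blockDiag ξ ξ₁≢0 ξ₂≢0 =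
    [ ξ₂≢0 ∘ proj₂ , ξ₁≢0 ∘ proj₂ ] ∘ to (isSignedColumn-blockDiag ξ)

module OrderedFieldProperties (ℝ : RealField) where
  open RealField ℝ
  open IsCommutativeRing isCommutativeRing
    using (+-comm; +-identityˡ; +-identityʳ; -‿inverseʳ; isRing)

  private
    ring : Ring _ _
    ring = record { isRing = isRing }
  open RingProperties ring using (-1*x≈-x; -‿involutive)

  -- If 1 < 0 then 0 < -1, hence 0 < (-1)(-1) = 1.
  0<1 : 0# < 1#
  0<1 with <-trichotomy 0# 1#
  ... | inj₁ 0<1 = 0<1
  ... | inj₂ (inj₁ 0≡1) = ⊥-elim (0≢1 0≡1)
  ... | inj₂ (inj₂ 1<0) = ⊥-elim (<-irrefl 0# (<-trans 0<[-1][-1] 1<0))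
    where
    0<-1 : 0# < - 1#
    0<-1 = subst₂ _<_ (-‿inverseʳ 1#) (+-identityˡ (- 1#)) (+-mono-< (- 1#) 1<0)
    0<[-1][-1] : 0# < 1#
    0<[-1][-1] = subst (0# <_) (trans (-1*x≈-x (- 1#)) (-‿involutive 1#)) (*-pos 0<-1 0<-1)

  <-≤-trans : ∀ {x y z} → x < y → y ≤ z → x < z
  <-≤-trans x<y (inj₁ y<z) = <-trans x<y y<z
  <-≤-trans x<y (inj₂ refl) = x<y

  +-monoʳ-≤ : ∀ {x y} z → x ≤ y → z + x ≤ z + y
  +-monoʳ-≤ {x} {y} z (inj₁ x<y) = inj₁ (subst₂ _<_ (+-comm x z) (+-comm y z) (+-mono-< z x<y))
  +-monoʳ-≤ z (inj₂ refl) = inj₂ refl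

  +-mono-<-≤ : ∀ {x y u v} → x < y → u ≤ v → x + u < y + v
  +-mono-<-≤ {y = y} {u = u} x<y u≤v = <-≤-trans (+-mono-< u x<y) (+-monoʳ-≤ y u≤v)

  +-mono-≤-< : ∀ {x y u v} → x ≤ y → u < v → x + u < y + v
  +-mono-≤-< {x} {y} {u} {v} x≤y u<v =
    subst₂ _<_ (+-comm u x) (+-comm v y) (+-mono-<-≤ u<v x≤y)

  x+y>0 : ∀ {x y} → 0# < x → 0# ≤ y → 0# < x + y
  x+y>0 0<x 0≤y = subst (_< _) (+-identityˡ 0#) (+-mono-<-≤ 0<x 0≤y)

  x+y>1 : ∀ {x y} → 1# ≤ x → 1# ≤ y → 1# < x + y
  x+y>1 1≤x 1≤y = subst (_< _) (+-identityʳ 1#) (+-mono-≤-< 1≤x (<-≤-trans 0<1 1≤y))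

  _≟0 : ∀ x → Dec (x ≡ 0#)
  x ≟0 with <-trichotomy x 0#
  ... | inj₁ x<0 = no (λ { refl → <-irrefl 0# x<0 })
  ... | inj₂ (inj₁ x≡0) = yes x≡0
  ... | inj₂ (inj₂ 0<x) = no (λ { refl → <-irrefl 0# 0<x })

  -- The shape of the condition on a single ξ in WellSuited.
  AtLeastOneWithEqualityIff : Carrier → Set → Set
  AtLeastOneWithEqualityIff q P = 1# ≤ q × (q ≡ 1# → P) × (P → q ≡ 1#)

  atLeastOneWithEqualityIff-transport : ∀ {q q′ P P′} → q ≡ q′ → P ⇔ P′ →
    AtLeastOneWithEqualityIff q P → AtLeastOneWithEqualityIff q′ P′
  atLeastOneWithEqualityIff-transport refl P⇔P′ (1≤q , q≡1⇒P , P⇒q≡1) =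
    1≤q , to P⇔P′ ∘ q≡1⇒P , P⇒q≡1 ∘ from P⇔P′

  atLeastOneWithEqualityIff-> : ∀ {q P} → 1# < q → ¬ P → AtLeastOneWithEqualityIff q P
  atLeastOneWithEqualityIff-> 1<q ¬P =
    inj₁ 1<q , (λ { refl → ⊥-elim (<-irrefl 1# 1<q) }) , ⊥-elim ∘ ¬P

module QuadraticFormProperties (ℝ : RealField) where
  open RealField ℝ
  open IsCommutativeRing isCommutativeRing using (+-assoc; +-identityˡ; +-identityʳ; zeroˡ; zeroʳ)
  open OrderedFieldProperties ℝ
  open ≡-Reasoning

  sum : ∀ {k} → (Fin k → Carrier) → Carrier
  sum = sumFin _+_ 0#

  sum-cong : ∀ {k} {f h : Fin k → Carrier} → (∀ i → f i ≡ h i) → sum f ≡ sum h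
  sum-cong {ℕ.zero} f≗h = refl
  sum-cong {ℕ.suc k} f≗h = cong₂ _+_ (f≗h zero) (sum-cong (f≗h ∘ suc))

  sum-zero : ∀ {k} {f : Fin k → Carrier} → (∀ i → f i ≡ 0#) → sum f ≡ 0#
  sum-zero {ℕ.zero} f≗0 = refl
  sum-zero {ℕ.suc k} f≗0 = trans (cong₂ _+_ (f≗0 zero) (sum-zero (f≗0 ∘ suc))) (+-identityˡ 0#)

  sum-++ : ∀ m {n} (f : Fin (m ℕ.+ n) → Carrier) → sum f ≡ sum (take m f) + sum (drop m f)
  sum-++ ℕ.zero f = sym (+-identityˡ (sum f))
  sum-++ (ℕ.suc m) f =
    trans (cong (λ s → f zero + s) (sum-++ m (f ∘ suc))) (sym (+-assoc (f zero) _ _))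

  sum-++-dropZero : ∀ m {n} {f : Fin (m ℕ.+ n) → Carrier} →
    (∀ i → drop m f i ≡ 0#) → sum f ≡ sum (take m f)
  sum-++-dropZero m {f = f} f₂≗0 = begin
    sum f                             ≡⟨ sum-++ m f ⟩
    sum (take m f) + sum (drop m f)   ≡⟨ cong (λ s → sum (take m f) + s) (sum-zero f₂≗0) ⟩
    sum (take m f) + 0#               ≡⟨ +-identityʳ _ ⟩
    sum (take m f)                    ∎

  sum-++-takeZero : ∀ m {n} {f : Fin (m ℕ.+ n) → Carrier} →
    (∀ i → take m f i ≡ 0#) → sum f ≡ sum (drop m f)
  sum-++-takeZero m {f = f} f₁≗0 = begin
    sum f                             ≡⟨ sum-++ m f ⟩
    sum (take m f) + sum (drop m f)   ≡⟨ cong (_+ sum (drop m f)) (sum-zero f₁≗0) ⟩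
    0# + sum (drop m f)               ≡⟨ +-identityˡ _ ⟩
    sum (drop m f)                    ∎

  qf-zero : ∀ {g} (Q : Matrix Carrier g g) x → (∀ i → x i ≡ 0#) → qf ℝ Q x ≡ 0#
  qf-zero Q x x≗0 = sum-zero λ i → sum-zero λ j →
    trans (cong (_* (Q i j * x j)) (x≗0 i)) (zeroˡ _)

  qf-nonneg : ∀ {g} {Q : Matrix Carrier g g} → PositiveDefinite ℝ Q → ∀ x → 0# ≤ qf ℝ Q x
  qf-nonneg {Q = Q} (_ , pos) x with all? (λ i → x i ≟0)
  ... | yes x≗0 = inj₂ (sym (qf-zero Q x x≗0))
  ... | no x≢0 = inj₁ (pos x x≢0)

  module _ {g₁ g₂} (Q₁ : Matrix Carrier g₁ g₁) (Q₂ : Matrix Carrier g₂ g₂) where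

    private
      Q : Matrix Carrier (g₁ ℕ.+ g₂) (g₁ ℕ.+ g₂)
      Q = blockDiag 0# Q₁ Q₂

      off-diagonal : ∀ {x y q} → q ≡ 0# → x * (q * y) ≡ 0#
      off-diagonal {x} refl = trans (cong (x *_) (zeroˡ _)) (zeroʳ x)

    qf-blockDiag : ∀ x → qf ℝ Q x ≡ qf ℝ Q₁ (take g₁ x) + qf ℝ Q₂ (drop g₁ x)
    qf-blockDiag x = trans (sum-++ g₁ _) (cong₂ _+_ (sum-cong upper) (sum-cong lower))
      where
      upper : ∀ i → sum (λ j → x (i ↑ˡ g₂) * (Q (i ↑ˡ g₂) j * x j)) ≡
                    sum (λ j → take g₁ x i * (Q₁ i j * take g₁ x j))
      upper i = trans
        (sum-++-dropZero g₁ (λ j → off-diagonal (blockDiag-↑ˡ-↑ʳ 0# Q₁ Q₂ i j)))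
        (sum-cong (λ j → cong (λ q → x (i ↑ˡ g₂) * (q * x (j ↑ˡ g₂))) (blockDiag-↑ˡ-↑ˡ 0# Q₁ Q₂ i j)))
      lower : ∀ i → sum (λ j → x (g₁ ↑ʳ i) * (Q (g₁ ↑ʳ i) j * x j)) ≡
                    sum (λ j → drop g₁ x i * (Q₂ i j * drop g₁ x j))
      lower i = trans
        (sum-++-takeZero g₁ (λ j → off-diagonal (blockDiag-↑ʳ-↑ˡ 0# Q₁ Q₂ i j)))
        (sum-cong (λ j → cong (λ q → x (g₁ ↑ʳ i) * (q * x (g₁ ↑ʳ j))) (blockDiag-↑ʳ-↑ʳ 0# Q₁ Q₂ i j)))

    qf-blockDiag-takeZero : ∀ x → (∀ i → take g₁ x i ≡ 0#) → qf ℝ Q x ≡ qf ℝ Q₂ (drop g₁ x)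
    qf-blockDiag-takeZero x x₁≗0 = begin
      qf ℝ Q x                                     ≡⟨ qf-blockDiag x ⟩
      qf ℝ Q₁ (take g₁ x) + qf ℝ Q₂ (drop g₁ x)    ≡⟨ cong (_+ _) (qf-zero Q₁ (take g₁ x) x₁≗0) ⟩
      0# + qf ℝ Q₂ (drop g₁ x)                     ≡⟨ +-identityˡ _ ⟩
      qf ℝ Q₂ (drop g₁ x)                          ∎

    qf-blockDiag-dropZero : ∀ x → (∀ i → drop g₁ x i ≡ 0#) → qf ℝ Q x ≡ qf ℝ Q₁ (take g₁ x)
    qf-blockDiag-dropZero x x₂≗0 = begin
      qf ℝ Q x                                     ≡⟨ qf-blockDiag x ⟩
      qf ℝ Q₁ (take g₁ x) + qf ℝ Q₂ (drop g₁ x)    ≡⟨ cong (λ q → qf ℝ Q₁ (take g₁ x) + q) (qf-zero Q₂ (drop g₁ x) x₂≗0) ⟩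
      qf ℝ Q₁ (take g₁ x) + 0#                     ≡⟨ +-identityʳ _ ⟩
      qf ℝ Q₁ (take g₁ x)                          ∎

    positiveDefinite-blockDiag : PositiveDefinite ℝ Q₁ → PositiveDefinite ℝ Q₂ → PositiveDefinite ℝ Q
    positiveDefinite-blockDiag (sym₁ , pos₁) pd₂@(sym₂ , pos₂) =
      blockDiag-symmetric 0# Q₁ Q₂ sym₁ sym₂ , pos
      where
      pos : ∀ x → ¬ (∀ i → x i ≡ 0#) → 0# < qf ℝ Q x
      pos x x≢0 with all? (λ i → take g₁ x i ≟0)
      ... | yes x₁≗0 = subst (0# <_) (sym (qf-blockDiag-takeZero x x₁≗0))
                         (pos₂ (drop g₁ x) (λ x₂≗0 → x≢0 (↑-elim _ x₁≗0 x₂≗0)))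
      ... | no x₁≢0 = subst (0# <_) (sym (qf-blockDiag x))
                        (x+y>0 (pos₁ (take g₁ x) x₁≢0) (qf-nonneg pd₂ (drop g₁ x)))

lemma4p2p3 : (ℝ : RealField) → ∀ {g₁ n₁ g₂ n₂}
    (A₁ : Matrix ℤ g₁ n₁) (A₂ : Matrix ℤ g₂ n₂)
    (Q₁ : Matrix (RealField.Carrier ℝ) g₁ g₁) (Q₂ : Matrix (RealField.Carrier ℝ) g₂ g₂) →
    Simple A₁ → TotallyUnimodular A₁ → Simple A₂ → TotallyUnimodular A₂ →
    PositiveDefinite ℝ Q₁ → WellSuited ℝ A₁ Q₁ →
    PositiveDefinite ℝ Q₂ → WellSuited ℝ A₂ Q₂ →
    WellSuited ℝ (blockDiag (+ 0) A₁ A₂) (blockDiag (RealField.0# ℝ) Q₁ Q₂)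
lemma4p2p3 ℝ {g₁} A₁ A₂ Q₁ Q₂ _ _ _ _ pd₁ (_ , ws₁) pd₂ (_ , ws₂) =
  positiveDefinite-blockDiag Q₁ Q₂ pd₁ pd₂ , wellSuited-at
  where
  open RealField ℝ using (_<_; 1#; fromℤ)
  open OrderedFieldProperties ℝ
  open QuadraticFormProperties ℝ

  wellSuited-at : ∀ ξ → ¬ IsZeroVec ξ → AtLeastOneWithEqualityIff
    (qf ℝ (blockDiag _ Q₁ Q₂) (fromℤ ∘ ξ)) (IsSignedColumn (blockDiag (+ 0) A₁ A₂) ξ)
  wellSuited-at ξ ξ≢0 with all? (λ i → take g₁ ξ i ℤ.≟ + 0) | all? (λ i → drop g₁ ξ i ℤ.≟ + 0)
  ... | yes ξ₁≗0 | yes ξ₂≗0 = ⊥-elim (ξ≢0 (↑-elim _ ξ₁≗0 ξ₂≗0))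
  ... | yes ξ₁≗0 | no ξ₂≢0 = atLeastOneWithEqualityIff-transport
    (sym (qf-blockDiag-takeZero Q₁ Q₂ (fromℤ ∘ ξ) (cong fromℤ ∘ ξ₁≗0)))
    (⇔.sym (isSignedColumn-blockDiag-takeZero A₁ A₂ ξ ξ₁≗0 ξ₂≢0))
    (ws₂ (drop g₁ ξ) ξ₂≢0)
  ... | no ξ₁≢0 | yes ξ₂≗0 = atLeastOneWithEqualityIff-transport
    (sym (qf-blockDiag-dropZero Q₁ Q₂ (fromℤ ∘ ξ) (cong fromℤ ∘ ξ₂≗0)))
    (⇔.sym (isSignedColumn-blockDiag-dropZero A₁ A₂ ξ ξ₂≗0 ξ₁≢0))
    (ws₁ (take g₁ ξ) ξ₁≢0)
  ... | no ξ₁≢0 | no ξ₂≢0 = atLeastOneWithEqualityIff->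
    (subst (1# <_) (sym (qf-blockDiag Q₁ Q₂ (fromℤ ∘ ξ)))
      (x+y>1 (proj₁ (ws₁ (take g₁ ξ) ξ₁≢0)) (proj₁ (ws₂ (drop g₁ ξ) ξ₂≢0))))
    (¬isSignedColumn-blockDiag A₁ A₂ ξ ξ₁≢0 ξ₂≢0)
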